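{- Let $\Gamma\neq\mathbb N$ be the semigroup associated to an irreducible plane curve singularity, minimally generated by $r_0<r_1<\cdots<r_h$, and with conductor $c=\mathrm c(\Gamma)$. Then $c\ge \frac53 2^{2h}-3\cdot 2^h+\frac43$.
   Context: A numerical semigroup is a submonoid $\Gamma$ of $(\mathbb N,+)$ with finite complement in $\mathbb N$; $\mathrm F(\Gamma)$ is the largest integer not in $\Gamma$ and $\mathrm c(\Gamma)=\mathrm F(\Gamma)+1$. $\langle X\rangle$ denotes the submonoid of $\mathbb N$ generated by $X$. For minimal generators listed in a fixed order $(r_0,\ldots,r_h)$, set $d_k=\gcd(r_0,\ldots,r_{k-1})$ for $k=1,\ldots,h+1$, $e_k=d_k/d_{k+1}$ for $k=1,\ldots,h$, and $\Gamma_k=\langle r_0/d_{k+1},\ldots,r_k/d_{k+1}\rangle$. Gluing: if $A$ is the minimal generating set of a numerical semigroup and $A=A_1\cup A_2$ is a nontrivial partition with $a_i=\gcd(A_i)$, then $A$ is the gluing of $A_1$ and $A_2$ if $\mathrm{lcm}(a_1,a_2)\in\langle A_1\rangle\cap\langle A_2\rangle$. $\Gamma$ is free for the arrangement $(r_0,\ldots,r_h)$ if either $h=0$ (so $r_0=1$) or $\{r_0,\ldots,r_h\}$ is the gluing of $\{r_0,\ldots,r_{h-1}\}$ and $\{r_h\}$ and $\Gamma_{h-1}$ is free for the arrangement $(r_0/d_h,\ldots,r_{h-1}/d_h)$. $\Gamma$ is telescopic if it is free for the increasing arrangement $r_0<\cdots<r_h$. $\Gamma$ is the semigroup associated to an irreducible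 plane curve singularity if it is telescopic and $e_kr_k<r_{k+1}$ for all $k=1,\ldots,h-1$. -}

module Defs where

open import Data.Nat using (ℕ; zero; suc; _+_; _*_; _/_; _≤_; _<_)
open import Data.Nat.Properties using (_≟_)
open import Data.Nat.GCD using (gcd)
open import Data.Nat.LCM using (lcm)
open import Data.List using (List; []; _∷_; map; upTo; filter; foldr)
open import Data.Product using (Σ; _×_)
open import Data.Sum using (_⊎_)
open import Data.Empty using (⊥)
open import Relation.Nullary using (¬_)
open import Relation.Nullary.Decidable using (¬?)
open import Relation.Binary.PropositionalEquality using (_≡_)

_∈⟨_⟩ : ℕ → List ℕ → Set
n ∈⟨ [] ⟩ = n ≡ 0
n ∈⟨ g ∷ gs ⟩ = Σ ℕ λ k → Σ ℕ λ m → (m ∈⟨ gs ⟩) × (n ≡ k * g + m)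

-- an arrangement is a sequence r : ℕ → ℕ of which only r 0 , … , r h matter
-- gens r k = [ r 0 , … , r (k-1) ]
gens : (ℕ → ℕ) → ℕ → List ℕ
gens r k = map r (upTo k)

gensExcept : (ℕ → ℕ) → ℕ → ℕ → List ℕ
gensExcept r h i = map r (filter (λ j → ¬? (j ≟ i)) (upTo (suc h)))

gcdList : List ℕ → ℕ
gcdList = foldr gcd 0

d : (ℕ → ℕ) → ℕ → ℕ
d r k = gcdList (gens r k)

-- division (with the junk value 0 for division by 0, which never occurs here)
_div_ : ℕ → ℕ → ℕ
x div zero = 0
x div suc m = x / suc m

IsNumericalSemigroupGens : List ℕ → Set
IsNumericalSemigroupGens gs = Σ ℕ λ N → ∀ n → N ≤ n → n ∈⟨ gs ⟩

IsMinGenNS : (ℕ → ℕ) → ℕ → Set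
IsMinGenNS r h = IsNumericalSemigroupGens (gens r (suc h))
               × (∀ i → i ≤ h → ¬ (r i ∈⟨ gensExcept r h i ⟩))

Free : (ℕ → ℕ) → ℕ → Set
Free r zero = IsMinGenNS r zero × (r 0 ≡ 1)
Free r (suc h) =
    IsMinGenNS r (suc h)
  -- gluing of {r_0..r_h} and {r_{h+1}} : lcm(a₁,a₂) ∈ ⟨A₁⟩ ∩ ⟨A₂⟩
  × ((lcm (d r (suc h)) (gcdList (r (suc h) ∷ [])) ∈⟨ gens r (suc h) ⟩)
     × (lcm (d r (suc h)) (gcdList (r (suc h) ∷ [])) ∈⟨ r (suc h) ∷ [] ⟩))
  × Free (λ i → r i div d r (suc h)) h

StrictlyIncreasing : (ℕ → ℕ) → ℕ → Set
StrictlyIncreasing r h = ∀ i → i < h → r i < r (suc i)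

Telescopic : (ℕ → ℕ) → ℕ → Set
Telescopic r h = StrictlyIncreasing r h × Free r h

e : (ℕ → ℕ) → ℕ → ℕ
e r k = d r k div d r (suc k)

IsPlaneCurveSemigroup : (ℕ → ℕ) → ℕ → Set
IsPlaneCurveSemigroup r h =
  Telescopic r h × (∀ k → 1 ≤ k → k < h → e r k * r k < r (suc k))

-- c is the conductor F(Γ)+1 of Γ = ⟨ gs ⟩ (c = 0 when Γ = ℕ)
IsConductor : List ℕ → ℕ → Set
IsConductor gs c = (∀ n → c ≤ n → n ∈⟨ gs ⟩) × ((c ≡ 0) ⊎ Σ ℕ λ f → (suc f ≡ c) × ¬ (f ∈⟨ gs ⟩))

-- For a free arrangement, Γ is glued from d·⟨r₀/d, …, r_h/d⟩ (d = d_{h+1}) and r_{h+1}, with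
-- gcd(d, r_{h+1}) = 1. If d·y + b·r_{h+1} were equal to Σₖ (eₖ − 1) rₖ − r₀, reducing mod d would force
-- b ≡ −1 (mod d), and stripping the surplus multiple of d·r_{h+1} (which lies in d·Γ_h) would give the
-- same identity one level down. So Σₖ (eₖ − 1) rₖ − r₀ is a gap and c ≥ Σₖ (eₖ − 1) rₖ − r₀ + 1.
-- The plane-curve inequalities r_{k+1} > eₖ rₖ, together with dₖ, eₖ ≥ 2, turn this into linear
-- recurrences bounding r_h and c from below, which are solved in closed form.
module Submission where

open import Defs
open import Data.Nat using (ℕ; zero; suc; _+_; _*_; _^_; _≤_; _<_; _∸_; s≤s; z≤n; NonZero; ≢-nonZero)
open import Data.Nat.Properties
open import Data.Nat.Divisibility using (_∣_; divides; _∣0; ∣-trans; m∣m*n; ∣n⇒∣m*n; ∣m∣n⇒∣m+n; ∣m+n∣m⇒∣n; 0∣⇒≡0; ∣1⇒≡1)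
open import Data.Nat.DivMod using (m*[n/m]≡n; m*n/m*o≡n/o; n/1≡n)
open import Data.Nat.GCD using (gcd; gcd[m,n]∣m; gcd[m,n]∣n; gcd-greatest; gcd-assoc; gcd-comm; gcd-identityʳ; c*gcd[m,n]≡gcd[cm,cn])
open import Data.Nat.LCM using (lcm; gcd*lcm)
open import Data.Nat.Coprimality using (Coprime; coprime-divisor; gcd≡1⇒coprime; coprime⇒gcd≡1)
open import Data.Nat.Tactic.RingSolver using (solve; solve-∀)
open import Data.List using ([]; _∷_; _++_; map; upTo)
open import Data.List.Properties using (upTo-∷ʳ; map-++; map-∘; map-cong-local)
open import Data.List.Relation.Unary.All using (tabulate)
open import Data.List.Relation.Unary.Any using (here; there)
open import Data.List.Membership.Propositional using (_∈_)
open import Data.List.Membership.Propositional.Properties using (∈-map⁺; ∈-map⁻; ∈-upTo⁺; ∈-upTo⁻; ∈-filter⁺)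
open import Data.Product using (∃-syntax; _×_; _,_; proj₁; proj₂)
open import Function using (_∘_)
open import Relation.Nullary using (¬_; yes; no; contradiction)
open import Relation.Nullary.Decidable using (¬?)
open import Relation.Binary.PropositionalEquality

∈⟨⟩-0 : ∀ gs → 0 ∈⟨ gs ⟩
∈⟨⟩-0 []       = refl
∈⟨⟩-0 (g ∷ gs) = 0 , 0 , ∈⟨⟩-0 gs , refl

∈⟨⟩-+ : ∀ gs {a b} → a ∈⟨ gs ⟩ → b ∈⟨ gs ⟩ → (a + b) ∈⟨ gs ⟩
∈⟨⟩-+ []       refl refl = refl
∈⟨⟩-+ (g ∷ gs) (k , m , m∈ , refl) (l , n , n∈ , refl) =
  k + l , m + n , ∈⟨⟩-+ gs m∈ n∈ , solve (k ∷ g ∷ m ∷ l ∷ n ∷ [])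

∈⟨⟩-* : ∀ gs c {a} → a ∈⟨ gs ⟩ → (c * a) ∈⟨ gs ⟩
∈⟨⟩-* []       c refl = *-zeroʳ c
∈⟨⟩-* (g ∷ gs) c (k , m , m∈ , refl) = c * k , c * m , ∈⟨⟩-* gs c m∈ , solve (c ∷ k ∷ g ∷ m ∷ [])

∈⇒∈⟨⟩ : ∀ {gs g} → g ∈ gs → g ∈⟨ gs ⟩
∈⇒∈⟨⟩ {g ∷ gs} (here refl)      = 1 , 0 , ∈⟨⟩-0 gs , solve (g ∷ [])
∈⇒∈⟨⟩ {_ ∷ _}  {g} (there g∈gs) = 0 , g , ∈⇒∈⟨⟩ g∈gs , refl

∈⟨⟩-⊆ : ∀ xs {ys} → (∀ {x} → x ∈ xs → x ∈⟨ ys ⟩) → ∀ {a} → a ∈⟨ xs ⟩ → a ∈⟨ ys ⟩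
∈⟨⟩-⊆ []       {ys} _   refl = ∈⟨⟩-0 ys
∈⟨⟩-⊆ (x ∷ xs) {ys} xs⊆ (k , m , m∈ , refl) =
  ∈⟨⟩-+ ys (∈⟨⟩-* ys k (xs⊆ (here refl))) (∈⟨⟩-⊆ xs (xs⊆ ∘ there) m∈)

∈⟨⟩⇒∣ : ∀ gs {c a} → (∀ {g} → g ∈ gs → c ∣ g) → a ∈⟨ gs ⟩ → c ∣ a
∈⟨⟩⇒∣ []       {c} _  refl = c ∣0
∈⟨⟩⇒∣ (g ∷ gs) c∣gs (k , m , m∈ , refl) =
  ∣m∣n⇒∣m+n (∣n⇒∣m*n k (c∣gs (here refl))) (∈⟨⟩⇒∣ gs (c∣gs ∘ there) m∈)

∈⟨++⟩⁻ : ∀ xs ys {a} → a ∈⟨ xs ++ ys ⟩ → ∃[ b ] ∃[ c ] b ∈⟨ xs ⟩ × c ∈⟨ ys ⟩ × a ≡ b + c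
∈⟨++⟩⁻ []       ys {a} a∈ = 0 , a , refl , a∈ , refl
∈⟨++⟩⁻ (x ∷ xs) ys (k , m , m∈ , refl) with ∈⟨++⟩⁻ xs ys m∈
... | b , c , b∈ , c∈ , refl = k * x + b , c , (k , b , b∈ , refl) , c∈ , sym (+-assoc (k * x) b c)

∈⟨map-*⟩⁻ : ∀ c gs {a} → a ∈⟨ map (c *_) gs ⟩ → ∃[ b ] b ∈⟨ gs ⟩ × a ≡ c * b
∈⟨map-*⟩⁻ c []       refl = 0 , refl , sym (*-zeroʳ c)
∈⟨map-*⟩⁻ c (g ∷ gs) (k , m , m∈ , refl) with ∈⟨map-*⟩⁻ c gs m∈
... | b , b∈ , refl = k * g + b , (k , b , b∈ , refl) , solve (k ∷ c ∷ g ∷ b ∷ [])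

gens-suc : ∀ r k → gens r (suc k) ≡ gens r k ++ r k ∷ []
gens-suc r k = trans (cong (map r) (sym (upTo-∷ʳ k))) (map-++ r (upTo k) (k ∷ []))

gens-cong : ∀ {r s} k → (∀ {i} → i < k → r i ≡ s i) → gens r k ≡ gens s k
gens-cong k r≗s = map-cong-local (tabulate (r≗s ∘ ∈-upTo⁻))

∈-gens⁺ : ∀ r {k i} → i < k → r i ∈ gens r k
∈-gens⁺ r i<k = ∈-map⁺ r (∈-upTo⁺ i<k)

∈-gens⁻ : ∀ r k {x} → x ∈ gens r k → ∃[ i ] i < k × x ≡ r i
∈-gens⁻ r k x∈ with i , i∈ , refl ← ∈-map⁻ r x∈ = i , ∈-upTo⁻ i∈ , refl

∈-gensExcept⁺ : ∀ r h j {i} → i ≤ h → i ≢ j → r i ∈ gensExcept r h j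
∈-gensExcept⁺ r h j i≤h i≢j = ∈-map⁺ r (∈-filter⁺ (λ x → ¬? (x ≟ j)) (∈-upTo⁺ (s≤s i≤h)) i≢j)

gcdList-∣ : ∀ {gs g} → g ∈ gs → gcdList gs ∣ g
gcdList-∣ {g ∷ gs} (here refl)  = gcd[m,n]∣m g (gcdList gs)
gcdList-∣ {g ∷ gs} (there x∈gs) = ∣-trans (gcd[m,n]∣n g (gcdList gs)) (gcdList-∣ x∈gs)

gcdList-greatest : ∀ gs {c} → (∀ {g} → g ∈ gs → c ∣ g) → c ∣ gcdList gs
gcdList-greatest []       {c} _ = c ∣0
gcdList-greatest (g ∷ gs) c∣gs = gcd-greatest (c∣gs (here refl)) (gcdList-greatest gs (c∣gs ∘ there))

gcdList-map-* : ∀ c gs → gcdList (map (c *_) gs) ≡ c * gcdList gs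
gcdList-map-* c []       = sym (*-zeroʳ c)
gcdList-map-* c (g ∷ gs) =
  trans (cong (gcd (c * g)) (gcdList-map-* c gs)) (sym (c*gcd[m,n]≡gcd[cm,cn] c g (gcdList gs)))

gcdList-∷ʳ : ∀ gs g → gcdList (gs ++ g ∷ []) ≡ gcd (gcdList gs) g
gcdList-∷ʳ []       g = gcd-comm g 0
gcdList-∷ʳ (x ∷ gs) g = trans (cong (gcd x) (gcdList-∷ʳ gs g)) (sym (gcd-assoc x (gcdList gs) g))

numericalSemigroup⇒gcdList≡1 : ∀ {gs} → IsNumericalSemigroupGens gs → gcdList gs ≡ 1
numericalSemigroup⇒gcdList≡1 {gs} (N , cofinite) = ∣1⇒≡1 (∣m+n∣m⇒∣n G∣N+1 G∣N)
  where
  G∣ : ∀ {n} → n ∈⟨ gs ⟩ → gcdList gs ∣ n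
  G∣ = ∈⟨⟩⇒∣ gs gcdList-∣
  G∣N : gcdList gs ∣ N
  G∣N = G∣ (cofinite N ≤-refl)
  G∣N+1 : gcdList gs ∣ N + 1
  G∣N+1 = subst (gcdList gs ∣_) (+-comm 1 N) (G∣ (cofinite (suc N) (n≤1+n N)))

m*[n÷m]≡n : ∀ {m n} → m ≢ 0 → m ∣ n → m * (n div m) ≡ n
m*[n÷m]≡n {zero}  m≢0 _   = contradiction refl m≢0
m*[n÷m]≡n {suc _} _   m∣n = m*[n/m]≡n m∣n

[c*m]÷[c*n]≡m÷n : ∀ {c m n} → c ≢ 0 → n ≢ 0 → (c * m) div (c * n) ≡ m div n
[c*m]÷[c*n]≡m÷n {zero}              c≢0 _   = contradiction refl c≢0
[c*m]÷[c*n]≡m÷n {suc _} {_} {zero}  _   n≢0 = contradiction refl n≢0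
[c*m]÷[c*n]≡m÷n {suc c} {m} {suc n} _   _   = m*n/m*o≡n/o (suc c) m (suc n)

d-suc : ∀ r k → d r (suc k) ≡ gcd (d r k) (r k)
d-suc r k = trans (cong gcdList (gens-suc r k)) (gcdList-∷ʳ (gens r k) (r k))

d∣r : ∀ r {k i} → i < k → d r k ∣ r i
d∣r r i<k = gcdList-∣ (∈-gens⁺ r i<k)

d≢0 : ∀ r k → r 0 ≢ 0 → d r (suc k) ≢ 0
d≢0 r k r₀≢0 d≡0 = r₀≢0 (0∣⇒≡0 (subst (_∣ r 0) d≡0 (d∣r r {suc k} (s≤s z≤n))))

minGen⇒≢0 : ∀ {r h i} → IsMinGenNS r h → i ≤ h → r i ≢ 0
minGen⇒≢0 {r} {h} {i} (_ , minimal) i≤h rᵢ≡0 =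
  minimal i i≤h (subst (_∈⟨ gensExcept r h i ⟩) (sym rᵢ≡0) (∈⟨⟩-0 _))

minGen⇒d≡1 : ∀ {r h} → IsMinGenNS r h → d r (suc h) ≡ 1
minGen⇒d≡1 (numerical , _) = numericalSemigroup⇒gcdList≡1 numerical

minGen⇒coprime : ∀ {r h} → IsMinGenNS r (suc h) → Coprime (d r (suc h)) (r (suc h))
minGen⇒coprime {r} {h} min = gcd≡1⇒coprime (trans (sym (d-suc r (suc h))) (minGen⇒d≡1 min))

coprime⇒lcm≡* : ∀ {m n} → Coprime m n → lcm m n ≡ m * n
coprime⇒lcm≡* {m} {n} m⊥n = begin
  lcm m n              ≡⟨ sym (*-identityˡ _) ⟩
  1 * lcm m n          ≡⟨ cong (_* lcm m n) (sym (coprime⇒gcd≡1 m⊥n)) ⟩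
  gcd m n * lcm m n    ≡⟨ gcd*lcm m n ⟩
  m * n                ∎
  where open ≡-Reasoning

Glued : (ℕ → ℕ) → ℕ → Set
Glued r h = lcm (d r (suc h)) (gcdList (r (suc h) ∷ [])) ∈⟨ gens r (suc h) ⟩

glued⇒d*r∈ : ∀ {r h} → IsMinGenNS r (suc h) → Glued r h → (d r (suc h) * r (suc h)) ∈⟨ gens r (suc h) ⟩
glued⇒d*r∈ {r} {h} min glued = subst (_∈⟨ gens r (suc h) ⟩) lcm≡d*r glued
  where
  lcm≡d*r : lcm (d r (suc h)) (gcd (r (suc h)) 0) ≡ d r (suc h) * r (suc h)
  lcm≡d*r = trans (cong (lcm (d r (suc h))) (gcd-identityʳ (r (suc h)))) (coprime⇒lcm≡* (minGen⇒coprime min))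

-- A glued-in generator is not already generated, so the gcd of the earlier ones is not 1.
free⇒2≤d : ∀ {r h} → Free r (suc h) → 2 ≤ d r (suc h)
free⇒2≤d {r} {h} (min@(_ , minimal) , (glued , _) , _) =
  ≤∧≢⇒< (n≢0⇒n>0 (d≢0 r h (minGen⇒≢0 min z≤n))) (≢-sym d≢1)
  where
  g : ℕ
  g = r (suc h)
  earlier⊆others : ∀ {x} → x ∈ gens r (suc h) → x ∈⟨ gensExcept r (suc h) (suc h) ⟩
  earlier⊆others x∈ with i , i<1+h , refl ← ∈-gens⁻ r (suc h) x∈ =
    ∈⇒∈⟨⟩ (∈-gensExcept⁺ r (suc h) (suc h) (<⇒≤ i<1+h) (<⇒≢ i<1+h))
  d≢1 : d r (suc h) ≢ 1
  d≢1 d≡1 = minimal (suc h) ≤-refl (∈⟨⟩-⊆ (gens r (suc h)) earlier⊆others g∈)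
    where
    g∈ : g ∈⟨ gens r (suc h) ⟩
    g∈ = subst (_∈⟨ gens r (suc h) ⟩) (trans (cong (_* g) d≡1) (*-identityˡ g)) (glued⇒d*r∈ min glued)

PlaneCondition : (ℕ → ℕ) → ℕ → Set
PlaneCondition r h = ∀ k → 1 ≤ k → k < h → e r k * r k < r (suc k)

module Rescaled (r : ℕ → ℕ) (h : ℕ) (r₀≢0 : r 0 ≢ 0) where

  D : ℕ
  D = d r (suc h)

  D≢0 : D ≢ 0
  D≢0 = d≢0 r h r₀≢0

  r′ : ℕ → ℕ
  r′ i = r i div D

  r≡D*r′ : ∀ {i} → i ≤ h → r i ≡ D * r′ i
  r≡D*r′ i≤h = sym (m*[n÷m]≡n D≢0 (d∣r r (s≤s i≤h)))

  gens≡map-D* : ∀ {k} → k ≤ suc h → gens r k ≡ map (D *_) (gens r′ k)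
  gens≡map-D* {k} k≤1+h =
    trans (gens-cong k (λ i<k → r≡D*r′ (≤-pred (≤-trans i<k k≤1+h)))) (map-∘ (upTo k))

  d≡D*d′ : ∀ {k} → k ≤ suc h → d r k ≡ D * d r′ k
  d≡D*d′ {k} k≤1+h = trans (cong gcdList (gens≡map-D* k≤1+h)) (gcdList-map-* D (gens r′ k))

  e′≡e : ∀ {k} → k ≤ h → e r′ k ≡ e r k
  e′≡e {k} k≤h = sym (trans (cong₂ _div_ (d≡D*d′ (m≤n⇒m≤1+n k≤h)) (d≡D*d′ (s≤s k≤h)))
                            ([c*m]÷[c*n]≡m÷n D≢0 d′≢0))
    where
    d′≢0 : d r′ (suc k) ≢ 0
    d′≢0 d′≡0 = d≢0 r k r₀≢0 (trans (d≡D*d′ (s≤s k≤h)) (trans (cong (D *_) d′≡0) (*-zeroʳ D)))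

  increasing′ : StrictlyIncreasing r (suc h) → StrictlyIncreasing r′ h
  increasing′ increasing i i<h = *-cancelˡ-< D (r′ i) (r′ (suc i))
    (subst₂ _<_ (r≡D*r′ (<⇒≤ i<h)) (r≡D*r′ i<h) (increasing i (m<n⇒m<1+n i<h)))

  plane′ : PlaneCondition r (suc h) → PlaneCondition r′ h
  plane′ plane k 1≤k k<h = *-cancelˡ-< D (e r′ k * r′ k) (r′ (suc k))
    (subst₂ _<_ eₖrₖ≡ (r≡D*r′ k<h) (plane k 1≤k (m<n⇒m<1+n k<h)))
    where
    eₖrₖ≡ : e r k * r k ≡ D * (e r′ k * r′ k)
    eₖrₖ≡ = begin
      e r k * r k           ≡⟨ cong₂ _*_ (sym (e′≡e (<⇒≤ k<h))) (r≡D*r′ (<⇒≤ k<h)) ⟩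
      e r′ k * (D * r′ k)   ≡⟨ sym (*-assoc (e r′ k) D (r′ k)) ⟩
      e r′ k * D * r′ k     ≡⟨ cong (_* r′ k) (*-comm (e r′ k) D) ⟩
      D * e r′ k * r′ k     ≡⟨ *-assoc D (e r′ k) (r′ k) ⟩
      D * (e r′ k * r′ k)   ∎
      where open ≡-Reasoning

-- Σₖ (eₖ − 1) rₖ for k = 1 … h: at the top level d_{h+1} = e_{h+1}, and below it every rₖ and eₖ
-- come from the rescaled arrangement (r_i / d_{h+1}).
frobenius+r₀ : (ℕ → ℕ) → ℕ → ℕ
frobenius+r₀ r zero    = 0
frobenius+r₀ r (suc h) =
  d r (suc h) * frobenius+r₀ (λ i → r i div d r (suc h)) h + (d r (suc h) ∸ 1) * r (suc h)

D*a+[1+b]*g≡D*[c+g]⇒a+q*g≡c : ∀ {D g a b c} .{{_ : NonZero D}} → Coprime D g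
  → D * a + suc b * g ≡ D * (c + g) → ∃[ q ] a + q * g ≡ c
D*a+[1+b]*g≡D*[c+g]⇒a+q*g≡c {D} {g} {a} {b} {c} D⊥g eq
  with coprime-divisor D⊥g (subst (D ∣_) (*-comm (suc b) g)
         (∣m+n∣m⇒∣n (subst (D ∣_) (sym eq) (m∣m*n (c + g))) (m∣m*n a)))
... | divides (suc q) 1+b≡[1+q]*D = q , +-cancelʳ-≡ g (a + q * g) c (*-cancelˡ-≡ _ _ D (begin
  D * (a + q * g + g)         ≡⟨ solve (D ∷ a ∷ q ∷ g ∷ []) ⟩
  D * a + suc q * D * g       ≡⟨ cong (λ x → D * a + x * g) (sym 1+b≡[1+q]*D) ⟩
  D * a + suc b * g           ≡⟨ eq ⟩
  D * (c + g)                 ∎))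
  where open ≡-Reasoning

m*n+[m∸1]*o+o≡m*[n+o] : ∀ {m} n o → m ≢ 0 → m * n + (m ∸ 1) * o + o ≡ m * (n + o)
m*n+[m∸1]*o+o≡m*[n+o] {zero}  _ _ m≢0 = contradiction refl m≢0
m*n+[m∸1]*o+o≡m*[n+o] {suc k} n o _   = identity k n o
  where
  identity : ∀ k n o → suc k * n + k * o + o ≡ suc k * (n + o)
  identity = solve-∀

module _ {r : ℕ → ℕ} {h : ℕ} (min : IsMinGenNS r (suc h)) where
  open Rescaled r h (minGen⇒≢0 min z≤n)

  private
    g : ℕ
    g = r (suc h)

  frobenius+r₀+g : frobenius+r₀ r (suc h) + g ≡ D * (frobenius+r₀ r′ h + g)
  frobenius+r₀+g = m*n+[m∸1]*o+o≡m*[n+o] (frobenius+r₀ r′ h) g D≢0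

  glued⇒g∈⟨gens′⟩ : Glued r h → g ∈⟨ gens r′ (suc h) ⟩
  glued⇒g∈⟨gens′⟩ glued =
    let z , z∈ , D*g≡D*z = ∈⟨map-*⟩⁻ D (gens r′ (suc h))
                             (subst ((D * g) ∈⟨_⟩) (gens≡map-D* ≤-refl) (glued⇒d*r∈ min glued))
    in subst (_∈⟨ gens r′ (suc h) ⟩) (sym (*-cancelˡ-≡ g z D {{≢-nonZero D≢0}} D*g≡D*z)) z∈

  rescale-gap-equation : ∀ {y b} → r 0 + (D * y + (b * g + 0)) ≡ frobenius+r₀ r (suc h)
    → D * (r′ 0 + y) + suc b * g ≡ D * (frobenius+r₀ r′ h + g)
  rescale-gap-equation {y} {b} r₀+x≡S = begin
    D * (r′ 0 + y) + suc b * g                ≡⟨ rearrange D (r′ 0) y b g ⟩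
    D * r′ 0 + (D * y + (b * g + 0)) + g      ≡⟨ cong (λ z → z + (D * y + (b * g + 0)) + g) (sym (r≡D*r′ z≤n)) ⟩
    r 0 + (D * y + (b * g + 0)) + g           ≡⟨ cong (_+ g) r₀+x≡S ⟩
    frobenius+r₀ r (suc h) + g                ≡⟨ frobenius+r₀+g ⟩
    D * (frobenius+r₀ r′ h + g)               ∎
    where
    open ≡-Reasoning
    rearrange : ∀ D a y b g → D * (a + y) + suc b * g ≡ D * a + (D * y + (b * g + 0)) + g
    rearrange = solve-∀

  frobenius+r₀-gap-step : Glued r h
    → (∀ x → x ∈⟨ gens r′ (suc h) ⟩ → r′ 0 + x ≢ frobenius+r₀ r′ h)
    → ∀ x → x ∈⟨ gens r (suc (suc h)) ⟩ → r 0 + x ≢ frobenius+r₀ r (suc h)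
  frobenius+r₀-gap-step glued gap′ x x∈ r₀+x≡S
    with a , _ , a∈ , (b , _ , refl , refl) , refl
           ← ∈⟨++⟩⁻ (gens r (suc h)) (g ∷ []) (subst (x ∈⟨_⟩) (gens-suc r (suc h)) x∈)
    with y , y∈ , refl ← ∈⟨map-*⟩⁻ D (gens r′ (suc h)) (subst (a ∈⟨_⟩) (gens≡map-D* ≤-refl) a∈)
    = let q , r′₀+y+qg≡S′ = D*a+[1+b]*g≡D*[c+g]⇒a+q*g≡c {b = b} {{≢-nonZero D≢0}} (minGen⇒coprime min)
                                 (rescale-gap-equation {y} {b} r₀+x≡S)
      in gap′ (y + q * g) (∈⟨⟩-+ _ y∈ (∈⟨⟩-* _ q (glued⇒g∈⟨gens′⟩ glued)))
              (trans (sym (+-assoc (r′ 0) y (q * g))) r′₀+y+qg≡S′)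

frobenius+r₀-gap : ∀ h {r} → Free r h → ∀ x → x ∈⟨ gens r (suc h) ⟩ → r 0 + x ≢ frobenius+r₀ r h
frobenius+r₀-gap zero    (_ , r₀≡1) x _ r₀+x≡0 = 1+n≢0 (trans (cong (_+ x) (sym r₀≡1)) r₀+x≡0)
frobenius+r₀-gap (suc h) (min , (glued , _) , free′) =
  frobenius+r₀-gap-step min glued (frobenius+r₀-gap h free′)

gap⇒s<c+a : ∀ {gs c a s} → (∀ n → c ≤ n → n ∈⟨ gs ⟩)
  → (∀ x → x ∈⟨ gs ⟩ → a + x ≢ s) → s < c + a
gap⇒s<c+a {gs} {c} {a} {s} complete gap with a ≤? s
... | no  a≰s = ≤-trans (≰⇒> a≰s) (m≤n+m a c)
... | yes a≤s = begin
  suc s             ≡⟨ cong suc (sym (m∸n+n≡m a≤s)) ⟩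
  suc (s ∸ a) + a   ≤⟨ +-monoˡ-≤ a (≰⇒> s∸a∉) ⟩
  c + a             ∎
  where
  open ≤-Reasoning
  s∸a∉ : ¬ c ≤ s ∸ a
  s∸a∉ c≤s∸a = gap (s ∸ a) (complete (s ∸ a) c≤s∸a) (trans (+-comm a (s ∸ a)) (m∸n+n≡m a≤s))

generatorBound : ℕ → ℕ
generatorBound zero    = 3
generatorBound (suc n) = 4 * generatorBound n + 1

conductorBound : ℕ → ℕ
conductorBound zero    = 2
conductorBound (suc n) = 2 * conductorBound n + 4 * generatorBound n

generatorBound-closed : ∀ n → 3 * generatorBound n + 1 ≡ 10 * 4 ^ n
generatorBound-closed zero    = refl
generatorBound-closed (suc n) = step (generatorBound n) (4 ^ n) (generatorBound-closed n)
  where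
  step : ∀ x p → 3 * x + 1 ≡ 10 * p → 3 * (4 * x + 1) + 1 ≡ 10 * (4 * p)
  step x p eq = begin
    3 * (4 * x + 1) + 1   ≡⟨ solve (x ∷ []) ⟩
    4 * (3 * x + 1)       ≡⟨ cong (4 *_) eq ⟩
    4 * (10 * p)          ≡⟨ solve (p ∷ []) ⟩
    10 * (4 * p)          ∎
    where open ≡-Reasoning

conductorBound-closed : ∀ n → 3 * conductorBound n + 9 * 2 ^ suc n ≡ 5 * 4 ^ suc n + 4
conductorBound-closed zero    = refl
conductorBound-closed (suc n) = step (conductorBound n) (generatorBound n) (2 ^ n) (4 ^ n)
  (conductorBound-closed n) (generatorBound-closed n)
  where
  step : ∀ c x t p → 3 * c + 9 * (2 * t) ≡ 5 * (4 * p) + 4 → 3 * x + 1 ≡ 10 * p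
       → 3 * (2 * c + 4 * x) + 9 * (2 * (2 * t)) ≡ 5 * (4 * (4 * p)) + 4
  step c x t p eq₁ eq₂ = +-cancelʳ-≡ 4 _ _ (begin
    3 * (2 * c + 4 * x) + 9 * (2 * (2 * t)) + 4   ≡⟨ solve (c ∷ x ∷ t ∷ []) ⟩
    2 * (3 * c + 9 * (2 * t)) + 4 * (3 * x + 1)   ≡⟨ cong₂ (λ u v → 2 * u + 4 * v) eq₁ eq₂ ⟩
    2 * (5 * (4 * p) + 4) + 4 * (10 * p)          ≡⟨ solve (p ∷ []) ⟩
    5 * (4 * (4 * p)) + 4 + 4                     ∎)
    where open ≡-Reasoning

conductorBound-base : ∀ {a b} → 2 ≤ a → a < b → 2 + a ≤ suc (a * 0 + (a ∸ 1) * b)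
conductorBound-base {a@(suc (suc k))} {b} (s≤s (s≤s _)) a<b = s≤s (begin
  3 + k               ≤⟨ a<b ⟩
  b                   ≤⟨ m≤m+n b (k * b) ⟩
  suc k * b           ≡⟨ cong (_+ suc k * b) (*-zeroʳ a) ⟨
  a * 0 + suc k * b   ∎)
  where open ≤-Reasoning

generatorBound-step : ∀ {e D x g b} → 2 ≤ e → 2 ≤ D → b ≤ x → e * (D * x) < g → 4 * b + 1 ≤ g
generatorBound-step {e} {D} {x} {g} {b} 2≤e 2≤D b≤x eDx<g = begin
  4 * b + 1           ≡⟨ solve (b ∷ []) ⟩
  suc (2 * (2 * b))   ≤⟨ s≤s (*-mono-≤ 2≤e (*-mono-≤ 2≤D b≤x)) ⟩
  suc (e * (D * x))   ≤⟨ eDx<g ⟩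
  g                   ∎
  where open ≤-Reasoning

conductorBound-step : ∀ {D c a s b g} → 2 ≤ D → c + a ≤ suc s → 4 * b + 1 ≤ g
  → 2 * c + 4 * b + D * a ≤ suc (D * s + (D ∸ 1) * g)
conductorBound-step {D@(suc (suc k))} {c} {a} {s} {b} {g} 2≤D@(s≤s (s≤s _)) c+a≤1+s 4b+1≤g = begin
  2 * c + 4 * b + D * a           ≤⟨ +-monoˡ-≤ (D * a) (+-monoˡ-≤ (4 * b) (*-monoˡ-≤ c 2≤D)) ⟩
  D * c + 4 * b + D * a           ≡⟨ solve (k ∷ c ∷ b ∷ a ∷ []) ⟩
  D * (c + a) + 4 * b             ≤⟨ +-monoˡ-≤ (4 * b) (*-monoʳ-≤ D c+a≤1+s) ⟩
  D * suc s + 4 * b               ≡⟨ solve (k ∷ s ∷ b ∷ []) ⟩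
  suc (D * s + (4 * b + suc k))   ≤⟨ s≤s (+-monoʳ-≤ (D * s) 4b+1+k≤[1+k]g) ⟩
  suc (D * s + suc k * g)         ∎
  where
  open ≤-Reasoning
  4b+1+k≤[1+k]g : 4 * b + suc k ≤ suc k * g
  4b+1+k≤[1+k]g = begin
    4 * b + suc k           ≤⟨ +-monoˡ-≤ (suc k) (m≤n*m (4 * b) (suc k)) ⟩
    suc k * (4 * b) + suc k ≡⟨ solve (k ∷ b ∷ []) ⟩
    suc k * (4 * b + 1)     ≤⟨ *-monoʳ-≤ (suc k) 4b+1≤g ⟩
    suc k * g               ∎

lowerBounds : ∀ n {r} → Free r (suc n) → StrictlyIncreasing r (suc n) → PlaneCondition r (suc n)
  → conductorBound n + r 0 ≤ suc (frobenius+r₀ r (suc n)) × generatorBound n ≤ r (suc n)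
lowerBounds zero {r} free increasing _ =
  subst (λ D → 2 + r 0 ≤ suc (D * 0 + (D ∸ 1) * r 1)) (sym d₁≡r₀) (conductorBound-base 2≤r₀ r₀<r₁) ,
  ≤-trans (s≤s 2≤r₀) r₀<r₁
  where
  d₁≡r₀ : d r 1 ≡ r 0
  d₁≡r₀ = gcd-identityʳ (r 0)
  2≤r₀ : 2 ≤ r 0
  2≤r₀ = subst (2 ≤_) d₁≡r₀ (free⇒2≤d free)
  r₀<r₁ : r 0 < r 1
  r₀<r₁ = increasing 0 (s≤s z≤n)
lowerBounds (suc n) {r} free@(min , _ , free′) increasing plane =
  subst (λ a → conductorBound (suc n) + a ≤ suc (frobenius+r₀ r (suc (suc n)))) (sym (r≡D*r′ z≤n))
        (conductorBound-step {b = generatorBound n} (free⇒2≤d free) (proj₁ IH) generator-bound) ,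
  generator-bound
  where
  open Rescaled r (suc n) (minGen⇒≢0 min z≤n)
  IH : conductorBound n + r′ 0 ≤ suc (frobenius+r₀ r′ (suc n)) × generatorBound n ≤ r′ (suc n)
  IH = lowerBounds n free′ (increasing′ increasing) (plane′ plane)
  d′≡e : d r′ (suc n) ≡ e r (suc n)
  d′≡e = begin
    d r′ (suc n)                             ≡⟨ n/1≡n _ ⟨
    d r′ (suc n) div 1                       ≡⟨ cong (d r′ (suc n) div_) (minGen⇒d≡1 (proj₁ free′)) ⟨
    e r′ (suc n)                             ≡⟨ e′≡e ≤-refl ⟩
    e r (suc n)                              ∎
    where open ≡-Reasoning
  generator-bound : generatorBound (suc n) ≤ r (suc (suc n))
  generator-bound = generatorBound-step (subst (2 ≤_) d′≡e (free⇒2≤d free′)) (free⇒2≤d free) (proj₂ IH)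
    (subst (λ x → e r (suc n) * x < r (suc (suc n))) (r≡D*r′ ≤-refl) (plane (suc n) (s≤s z≤n) ≤-refl))

proposition5p2 : (h : ℕ) (r : ℕ → ℕ) (c : ℕ)
    → IsMinGenNS r h
    → IsPlaneCurveSemigroup r h
    → ¬ (∀ n → n ∈⟨ gens r (suc h) ⟩)
    → IsConductor (gens r (suc h)) c
    → 5 * 4 ^ h + 4 ≤ 3 * c + 9 * 2 ^ h
proposition5p2 zero    _ c _ _ _ _ = m≤n+m 9 (3 * c)
proposition5p2 (suc n) r c _ ((increasing , free) , plane) _ (complete , _) = begin
  5 * 4 ^ suc n + 4                      ≡⟨ conductorBound-closed n ⟨
  3 * conductorBound n + 9 * 2 ^ suc n   ≤⟨ +-monoˡ-≤ (9 * 2 ^ suc n) (*-monoʳ-≤ 3 bound≤c) ⟩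
  3 * c + 9 * 2 ^ suc n                  ∎
  where
  open ≤-Reasoning
  bound≤c : conductorBound n ≤ c
  bound≤c = +-cancelʳ-≤ (r 0) (conductorBound n) c
    (≤-trans (proj₁ (lowerBounds n free increasing plane))
             (gap⇒s<c+a complete (frobenius+r₀-gap (suc n) free)))
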